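{- Let $G$ be a $(P_2\cup P_4,\ \mathrm{HVN})$-free graph with $\omega=\omega(G)\ge 4$. Let $A$ be an induced complete $\omega$-partite subgraph of $G$ of maximum order, let $H=G-V(A)$, and let $k=\omega(H)$. Suppose $k\ge 4$, and let $B$ be an induced complete $k$-partite subgraph of $H$ of maximum order, with parts $B_1,\dots,B_k$. Then for every vertex $v\in V(H)\setminus V(B)$, the set $N_B(v)$ of neighbours of $v$ in $V(B)$ intersects at most one of the parts $B_1,\dots,B_k$.
   Context: All graphs are finite and simple. $P_2\cup P_4$ is the disjoint union of the paths on $2$ and $4$ vertices; the HVN is $K_5$ minus two edges incident to a common vertex; "$H$-free" means no induced subgraph isomorphic to $H$. A complete $m$-partite graph has its vertex set partitioned into $m$ nonempty stable sets (parts) with any two vertices in different parts adjacent. -}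

module Defs where

open import Data.Nat using (ℕ; zero; suc; _≤_; _≡ᵇ_)
open import Data.Bool using (Bool; true; false; not; _∧_; _∨_)
open import Data.Fin using (Fin; toℕ)
open import Data.Fin.Subset using (Subset; _∈_; _⊆_; ∣_∣; ∁)
open import Data.Maybe using (Maybe; just; nothing; is-just)
open import Data.Vec using (tabulate)
open import Data.Product using (Σ; ∃; _×_; _,_)
open import Function.Definitions using (Injective)
open import Relation.Binary.PropositionalEquality using (_≡_; _≢_)
open import Relation.Nullary using (¬_)

record Graph (n : ℕ) : Set where
  field
    adj   : Fin n → Fin n → Bool
    sym   : ∀ u v → adj u v ≡ adj v u
    irref : ∀ v → adj v v ≡ false

open Graph public

Adj : ∀ {n} → Graph n → Fin n → Fin n → Set
Adj G u v = adj G u v ≡ true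

ContainsInduced : ∀ {m n} → Graph n → (Fin m → Fin m → Bool) → Set
ContainsInduced {m} {n} G h =
  Σ (Fin m → Fin n) λ f → Injective _≡_ _≡_ f × (∀ i j → i ≢ j → adj G (f i) (f j) ≡ h i j)

Free : ∀ {m n} → Graph n → (Fin m → Fin m → Bool) → Set
Free G h = ¬ ContainsInduced G h

P2∪P4 : Fin 6 → Fin 6 → Bool
P2∪P4 i j = e (toℕ i) (toℕ j) ∨ e (toℕ j) (toℕ i)
  where
    e : ℕ → ℕ → Bool
    e x y = ((x ≡ᵇ 0) ∧ (y ≡ᵇ 1)) ∨ ((x ≡ᵇ 2) ∧ (y ≡ᵇ 3))
            ∨ ((x ≡ᵇ 3) ∧ (y ≡ᵇ 4)) ∨ ((x ≡ᵇ 4) ∧ (y ≡ᵇ 5))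

-- HVN = K₅ minus the two edges 01 and 02 (both incident to vertex 0).
HVN : Fin 5 → Fin 5 → Bool
HVN i j = not (toℕ i ≡ᵇ toℕ j) ∧ not (missing (toℕ i) (toℕ j) ∨ missing (toℕ j) (toℕ i))
  where
    missing : ℕ → ℕ → Bool
    missing x y = (x ≡ᵇ 0) ∧ ((y ≡ᵇ 1) ∨ (y ≡ᵇ 2))

-- Everything below is relative to a vertex set U : Subset n, i.e. it is
-- about the induced subgraph G[U].  (G itself: U = ⊤;  G - V(A): U = ∁ V(A).)

IsCliqueIn : ∀ {n} → Graph n → Subset n → Subset n → Set
IsCliqueIn G U S = S ⊆ U × (∀ u v → u ∈ S → v ∈ S → u ≢ v → Adj G u v)

CliqueNumberIn : ∀ {n} → Graph n → Subset n → ℕ → Set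
CliqueNumberIn G U w =
  (Σ (Subset _) λ S → IsCliqueIn G U S × ∣ S ∣ ≡ w)
  × (∀ S → IsCliqueIn G U S → ∣ S ∣ ≤ w)

-- An induced complete m-partite subgraph of G[U], given by a labelling
-- lab : vertices → Maybe (part index); its vertex set is {v | lab v ≠ nothing}
-- and part i is {v | lab v = just i}.
record CompleteMultipartiteIn {n} (G : Graph n) (U : Subset n) (m : ℕ)
                              (lab : Fin n → Maybe (Fin m)) : Set where
  field
    inU      : ∀ v i → lab v ≡ just i → v ∈ U
    nonempty : ∀ i → ∃ λ v → lab v ≡ just i
    stable   : ∀ u v i → lab u ≡ just i → lab v ≡ just i → ¬ Adj G u v
    complete : ∀ u v i j → lab u ≡ just i → lab v ≡ just j → i ≢ j → Adj G u v

vertexSet : ∀ {n m} → (Fin n → Maybe (Fin m)) → Subset n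
vertexSet lab = tabulate (λ v → is-just (lab v))

order : ∀ {n m} → (Fin n → Maybe (Fin m)) → ℕ
order lab = ∣ vertexSet lab ∣

MaxCompleteMultipartiteIn : ∀ {n} → Graph n → Subset n → (m : ℕ) → (Fin n → Maybe (Fin m)) → Set
MaxCompleteMultipartiteIn G U m lab =
  CompleteMultipartiteIn G U m lab
  × (∀ lab' → CompleteMultipartiteIn G U m lab' → order lab' ≤ order lab)

{-# OPTIONS --safe #-}
-- Suppose v sees x ∈ B_i and y ∈ B_j with i ≠ j. If v had a neighbour in every part, these
-- neighbours together with v would be a clique of size k + 1 in H, so some part B_p contains
-- no neighbour of v (and p ≠ i, j). Vertices from four distinct parts of B form a K₄, and in an
-- HVN-free graph no vertex sees exactly two vertices of a K₄. Taking a vertex of B_p as a common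
-- non-neighbour and a fourth part q (k ≥ 4), this forces v to see all of B_q and then every
-- vertex outside B_p. But then B with v added to B_p is a larger complete k-partite subgraph of H.
module Submission where

open import Defs
open import Data.Bool using (Bool; true)
import Data.Bool as Bool
open import Data.Bool.Properties using (¬-not)
open import Data.Empty using (⊥)
open import Data.Fin using (Fin; zero; suc; _≟_)
open import Data.Fin.Patterns using (0F; 1F; 2F; 3F)
open import Data.Fin.Properties using (any?; all?; ¬∀⟶∃¬; injective⇒≤; suc-injective)
open import Data.Fin.Subset using (Subset; _∈_; _∉_; _⊆_; ⊤; ∁; ∣_∣; _-_)
open import Data.Fin.Subset.Properties using (x∈p∧x≢y⇒x∈p-y; x∈p⇒∣p-x∣<∣p∣; p⊂q⇒∣p∣<∣q∣)
open import Data.Maybe using (Maybe; just; nothing; is-just)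
open import Data.Maybe.Properties using (just-injective)
import Data.Maybe.Properties as Maybe
open import Data.Nat using (ℕ; suc; _≤_; _<_; z≤n; s≤s)
open import Data.Nat.Properties using (≤-trans; <-≤-trans; <⇒≱; 1+n≰n)
open import Data.Product using (∃; _×_; _,_; proj₁; proj₂)
open import Data.Sum using (_⊎_; inj₁; inj₂)
open import Data.Vec using ([]; _∷_; tabulate; lookup)
open import Data.Vec.Properties using (lookup∘tabulate; []=⇒lookup; lookup⇒[]=)
open import Data.Vec.Relation.Unary.All using ([]; _∷_)
open import Data.Vec.Relation.Unary.AllPairs using ([]; _∷_)
open import Data.Vec.Relation.Unary.Unique.Propositional using (Unique)
open import Data.Vec.Relation.Unary.Unique.Propositional.Properties using (lookup-injective)
open import Data.Vec.Functional using (updateAt)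
open import Data.Vec.Functional.Properties using (updateAt-updates; updateAt-minimal)
open import Function using (_∘_; const)
open import Function.Definitions using (Injective)
open import Relation.Binary.PropositionalEquality
  using (_≡_; _≢_; refl; trans; cong; subst; ≢-sym)
import Relation.Binary.PropositionalEquality as ≡
open import Relation.Nullary using (¬_; Dec; yes; no; does; contradiction)
open import Relation.Nullary.Decidable
  using (toWitness; dec-true; dec-false; decidable-stable; ¬?; _×-dec_; _→-dec_)

module _ {n} {b : Fin n → Bool} {x : Fin n} where

  ∈-tabulate⁺ : b x ≡ true → x ∈ tabulate b
  ∈-tabulate⁺ bx = lookup⇒[]= x (tabulate b) (trans (lookup∘tabulate b x) bx)

  ∈-tabulate⁻ : x ∈ tabulate b → b x ≡ true
  ∈-tabulate⁻ x∈ = trans (≡.sym (lookup∘tabulate b x)) ([]=⇒lookup x∈)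

module _ {m n} (f : Fin m → Fin n) where

  image : Subset n
  image = tabulate λ x → does (any? λ i → f i ≟ x)

  ∈-image⁺ : ∀ i → f i ∈ image
  ∈-image⁺ i = ∈-tabulate⁺ (dec-true (any? λ j → f j ≟ f i) (i , refl))

  ∈-image⁻ : ∀ {x} → x ∈ image → ∃ λ i → f i ≡ x
  ∈-image⁻ {x} x∈ = decidable-stable x? λ ∄ →
    contradiction (trans (≡.sym (∈-tabulate⁻ x∈)) (dec-false x? ∄)) λ ()
    where x? = any? λ i → f i ≟ x

injective⇒≤∣p∣ : ∀ {m n} {f : Fin m → Fin n} {p : Subset n} →
  Injective _≡_ _≡_ f → (∀ i → f i ∈ p) → m ≤ ∣ p ∣
injective⇒≤∣p∣ {m = 0} _ _ = z≤n
injective⇒≤∣p∣ {m = suc m} {f = f} {p} f-inj f∈p =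
  <-≤-trans (s≤s (injective⇒≤∣p∣ {f = f ∘ suc} {p - f zero} (suc-injective ∘ f-inj) f∘suc∈p-f0))
            (x∈p⇒∣p-x∣<∣p∣ (f∈p zero))
  where
  f∘suc∈p-f0 : ∀ i → f (suc i) ∈ p - f zero
  f∘suc∈p-f0 i = x∈p∧x≢y⇒x∈p-y (f∈p (suc i)) λ eq → contradiction (f-inj eq) λ ()

onto⇒≤ : ∀ {m k} (f : Fin m → Fin k) → (∀ q → ∃ λ i → f i ≡ q) → k ≤ m
onto⇒≤ f onto = injective⇒≤ {f = proj₁ ∘ onto} λ {q} {q'} eq →
  trans (≡.sym (proj₂ (onto q))) (trans (cong f eq) (proj₂ (onto q')))

<⇒∃-missed : ∀ {m k} → m < k → (f : Fin m → Fin k) → ∃ λ q → ∀ i → f i ≢ q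
<⇒∃-missed m<k f = decidable-stable (any? λ q → all? λ i → ¬? (f i ≟ q)) λ ∄missed →
  <⇒≱ m<k (onto⇒≤ f λ q → decidable-stable (any? λ i → f i ≟ q) λ ∄ →
    ∄missed (q , λ i fi≡q → ∄ (i , fi≡q)))

module _ {n m} {lab : Fin n → Maybe (Fin m)} {u : Fin n} where

  ∈-vertexSet⁺ : ∀ {i} → lab u ≡ just i → u ∈ vertexSet lab
  ∈-vertexSet⁺ lab-u = ∈-tabulate⁺ (cong is-just lab-u)

  ∈-vertexSet⁻ : u ∈ vertexSet lab → ∃ λ i → lab u ≡ just i
  ∈-vertexSet⁻ u∈ with lab u | ∈-tabulate⁻ {b = is-just ∘ lab} u∈
  ... | just i | _ = i , refl

  ∉-vertexSet : lab u ≡ nothing → u ∉ vertexSet lab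
  ∉-vertexSet lab-u u∈ with trans (≡.sym (∈-tabulate⁻ u∈)) (cong is-just lab-u)
  ... | ()

addToPart : ∀ {n m} → (Fin n → Maybe (Fin m)) → Fin n → Fin m → Fin n → Maybe (Fin m)
addToPart lab v p = updateAt lab v (const (just p))

module _ {n m} {lab : Fin n → Maybe (Fin m)} {v : Fin n} {p : Fin m} (lab-v : lab v ≡ nothing) where

  addToPart-extends : ∀ {u j} → lab u ≡ just j → addToPart lab v p u ≡ just j
  addToPart-extends {u} lab-u = trans (updateAt-minimal u v lab u≢v) lab-u
    where
    u≢v : u ≢ v
    u≢v refl with trans (≡.sym lab-u) lab-v
    ... | ()

  addToPart-view : ∀ {u r} → addToPart lab v p u ≡ just r → (u ≡ v × r ≡ p) ⊎ lab u ≡ just r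
  addToPart-view {u} lab+v-u with u ≟ v
  ... | yes refl = inj₁ (refl , just-injective (trans (≡.sym lab+v-u) (updateAt-updates v lab)))
  ... | no u≢v   = inj₂ (trans (≡.sym (updateAt-minimal u v lab u≢v)) lab+v-u)

  addToPart-order : order lab < order (addToPart lab v p)
  addToPart-order =
    p⊂q⇒∣p∣<∣q∣ (vertexSet-⊆ , v , ∈-vertexSet⁺ {lab = addToPart lab v p} (updateAt-updates v lab)
                             , ∉-vertexSet {lab = lab} lab-v)
    where
    vertexSet-⊆ : vertexSet lab ⊆ vertexSet (addToPart lab v p)
    vertexSet-⊆ u∈ =
      ∈-vertexSet⁺ {lab = addToPart lab v p} (addToPart-extends (proj₂ (∈-vertexSet⁻ {lab = lab} u∈)))

HVN-symmetric : ∀ i j → HVN i j ≡ HVN j i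
HVN-symmetric = toWitness {a? = all? λ i → all? λ j → HVN i j Bool.≟ HVN j i} _

HVN-suc-adjacent : ∀ a b → a ≢ b → HVN (suc a) (suc b) ≡ true
HVN-suc-adjacent =
  toWitness {a? = all? λ a → all? λ b → ¬? (a ≟ b) →-dec HVN (suc a) (suc b) Bool.≟ true} _

module _ {n} (G : Graph n) where

  Adj-sym : ∀ {u w} → Adj G u w → Adj G w u
  Adj-sym {u} {w} u~w = trans (Graph.sym G w u) u~w

  Adj⇒≢ : ∀ {u w} → Adj G u w → u ≢ w
  Adj⇒≢ {u} u~u refl with trans (≡.sym u~u) (irref G u)
  ... | ()

  PairwiseAdjacent : ∀ {m} → (Fin m → Fin n) → Set
  PairwiseAdjacent W = ∀ a b → a ≢ b → Adj G (W a) (W b)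

  pairwiseAdjacent⇒injective : ∀ {m} {W : Fin m → Fin n} →
    PairwiseAdjacent W → Injective _≡_ _≡_ W
  pairwiseAdjacent⇒injective {W = W} W-adj {a} {b} Wa≡Wb =
    decidable-stable (a ≟ b) λ a≢b → Adj⇒≢ (W-adj a b a≢b) Wa≡Wb

  pairwiseAdjacent⇒≤ : ∀ {m U w} {W : Fin m → Fin n} →
    (∀ S → IsCliqueIn G U S → ∣ S ∣ ≤ w) → PairwiseAdjacent W → (∀ a → W a ∈ U) → m ≤ w
  pairwiseAdjacent⇒≤ {U = U} {W = W} bound W-adj W∈U =
    ≤-trans (injective⇒≤∣p∣ (pairwiseAdjacent⇒injective W-adj) (∈-image⁺ W))
            (bound (image W) (image⊆U , image-clique))
    where
    image⊆U : image W ⊆ U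
    image⊆U x∈ with ∈-image⁻ W x∈
    ... | a , refl = W∈U a

    image-clique : ∀ u w → u ∈ image W → w ∈ image W → u ≢ w → Adj G u w
    image-clique u w u∈ w∈ u≢w with ∈-image⁻ W u∈ | ∈-image⁻ W w∈
    ... | a , refl | b , refl = W-adj a b (u≢w ∘ cong W)

  HVN-free⇒¬sees-exactly-two-of-K₄ : Free G HVN → ∀ {v} {W : Fin 4 → Fin n} → PairwiseAdjacent W →
    ¬ Adj G v (W 0F) → ¬ Adj G v (W 1F) → Adj G v (W 2F) → Adj G v (W 3F) → ⊥
  HVN-free⇒¬sees-exactly-two-of-K₄ hvn {v} {W} W-adj v≁W₀ v≁W₁ v~W₂ v~W₃ =
    hvn (f , f-injective , f-induces-HVN)
    where
    f : Fin 5 → Fin n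
    f zero    = v
    f (suc a) = W a

    v-row : ∀ a → adj G v (W a) ≡ HVN 0F (suc a)
    v-row 0F = ¬-not v≁W₀
    v-row 1F = ¬-not v≁W₁
    v-row 2F = v~W₂
    v-row 3F = v~W₃

    f-induces-HVN : ∀ i j → i ≢ j → adj G (f i) (f j) ≡ HVN i j
    f-induces-HVN zero    zero    i≢j = contradiction refl i≢j
    f-induces-HVN zero    (suc b) _   = v-row b
    f-induces-HVN (suc a) zero    _   =
      trans (Graph.sym G (W a) v) (trans (v-row a) (HVN-symmetric 0F (suc a)))
    f-induces-HVN (suc a) (suc b) i≢j =
      trans (W-adj a b (i≢j ∘ cong suc)) (≡.sym (HVN-suc-adjacent a b (i≢j ∘ cong suc)))

    v≢W : ∀ a → v ≢ W a
    v≢W 0F v≡W₀ = v≁W₁ (subst (λ u → Adj G u (W 1F)) (≡.sym v≡W₀) (W-adj 0F 1F λ ()))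
    v≢W 1F v≡W₁ = v≁W₀ (subst (λ u → Adj G u (W 0F)) (≡.sym v≡W₁) (W-adj 1F 0F λ ()))
    v≢W 2F = Adj⇒≢ v~W₂
    v≢W 3F = Adj⇒≢ v~W₃

    f-injective : Injective _≡_ _≡_ f
    f-injective {zero}  {zero}  _     = refl
    f-injective {zero}  {suc b} v≡Wb  = contradiction v≡Wb (v≢W b)
    f-injective {suc a} {zero}  Wa≡v  = contradiction (≡.sym Wa≡v) (v≢W a)
    f-injective {suc a} {suc b} Wa≡Wb = cong suc (pairwiseAdjacent⇒injective W-adj Wa≡Wb)

module _ {n k} {G : Graph n} {U : Subset n} {B : Fin n → Maybe (Fin k)}
         (B-cmp : CompleteMultipartiteIn G U k B) where
  open CompleteMultipartiteIn B-cmp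

  transversal⇒pairwiseAdjacent : ∀ {m} {W : Fin m → Fin n} {R : Fin m → Fin k} →
    (∀ a → B (W a) ≡ just (R a)) → Injective _≡_ _≡_ R → PairwiseAdjacent G W
  transversal⇒pairwiseAdjacent W∈R R-inj a b a≢b = complete _ _ _ _ (W∈R a) (W∈R b) (a≢b ∘ R-inj)

  SeesPart : Fin n → Fin k → Set
  SeesPart v p = ∃ λ w → B w ≡ just p × Adj G v w

  sees? : ∀ v p → Dec (SeesPart v p)
  sees? v p = any? λ w → Maybe.≡-dec _≟_ (B w) (just p) ×-dec adj G v w Bool.≟ true

  ¬sees-every-part : (∀ S → IsCliqueIn G U S → ∣ S ∣ ≤ k) → ∀ {v} → v ∈ U → ¬ (∀ p → SeesPart v p)
  ¬sees-every-part bound {v} v∈U sees = 1+n≰n (pairwiseAdjacent⇒≤ G bound W-adj W∈U)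
    where
    W : Fin (suc k) → Fin n
    W zero    = v
    W (suc p) = proj₁ (sees p)

    W-adj : PairwiseAdjacent G W
    W-adj zero    zero    0≢0 = contradiction refl 0≢0
    W-adj zero    (suc p) _   = proj₂ (proj₂ (sees p))
    W-adj (suc p) zero    _   = Adj-sym G (proj₂ (proj₂ (sees p)))
    W-adj (suc p) (suc q) p≢q =
      transversal⇒pairwiseAdjacent (proj₁ ∘ proj₂ ∘ sees) (λ eq → eq) p q (p≢q ∘ cong suc)

    W∈U : ∀ a → W a ∈ U
    W∈U zero    = v∈U
    W∈U (suc p) = inU _ p (proj₁ (proj₂ (sees p)))

  sees-two-misses-one⇒adjacent : Free G HVN → ∀ {v w a x y t p r s} → Unique (t ∷ p ∷ r ∷ s ∷ []) →
    B w ≡ just t → B a ≡ just p → B x ≡ just r → B y ≡ just s →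
    ¬ Adj G v a → Adj G v x → Adj G v y → Adj G v w
  sees-two-misses-one⇒adjacent hvn {v} {w} {a} {x} {y} {t} {p} {r} {s}
                               distinct Bw Ba Bx By v≁a v~x v~y =
    decidable-stable (adj G v w Bool.≟ true) λ v≁w →
      HVN-free⇒¬sees-exactly-two-of-K₄ G hvn K₄ v≁w v≁a v~x v~y
    where
    W∈R : ∀ c → B (lookup (w ∷ a ∷ x ∷ y ∷ []) c) ≡ just (lookup (t ∷ p ∷ r ∷ s ∷ []) c)
    W∈R 0F = Bw
    W∈R 1F = Ba
    W∈R 2F = Bx
    W∈R 3F = By

    K₄ : PairwiseAdjacent G (lookup (w ∷ a ∷ x ∷ y ∷ []))
    K₄ = transversal⇒pairwiseAdjacent W∈R (lookup-injective distinct _ _)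

  module _ (hvn : Free G HVN) (k≥4 : 4 ≤ k) {v x y i j p} (i≢j : i ≢ j)
           (Bx : B x ≡ just i) (By : B y ≡ just j) (v~x : Adj G v x) (v~y : Adj G v y)
           (unseen : ¬ SeesPart v p) where
    private
      p≢i : p ≢ i
      p≢i refl = unseen (x , Bx , v~x)

      p≢j : p ≢ j
      p≢j refl = unseen (y , By , v~y)

      fourth = <⇒∃-missed k≥4 (lookup (i ∷ j ∷ p ∷ []))
      q = proj₁ fourth

      i≢q : i ≢ q
      i≢q = proj₂ fourth 0F
      j≢q : j ≢ q
      j≢q = proj₂ fourth 1F
      p≢q : p ≢ q
      p≢q = proj₂ fourth 2F

      a = proj₁ (nonempty p)
      Ba = proj₂ (nonempty p)
      b = proj₁ (nonempty q)
      Bb = proj₂ (nonempty q)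

      v≁a : ¬ Adj G v a
      v≁a v~a = unseen (a , Ba , v~a)

      v~b : Adj G v b
      v~b = sees-two-misses-one⇒adjacent hvn
              ((≢-sym p≢q ∷ ≢-sym i≢q ∷ ≢-sym j≢q ∷ []) ∷ (p≢i ∷ p≢j ∷ []) ∷ (i≢j ∷ []) ∷ [] ∷ [])
              Bb Ba Bx By v≁a v~x v~y

    -- Each case uses two neighbours of v among x, y, b whose parts differ from r.
    adjacent-outside-unseen-part : ∀ {w r} → B w ≡ just r → r ≢ p → Adj G v w
    adjacent-outside-unseen-part {r = r} Bw r≢p with r ≟ i | r ≟ j
    ... | yes refl | _ =
      sees-two-misses-one⇒adjacent hvn
        ((r≢p ∷ i≢j ∷ i≢q ∷ []) ∷ (p≢j ∷ p≢q ∷ []) ∷ (j≢q ∷ []) ∷ [] ∷ []) Bw Ba By Bb v≁a v~y v~b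
    ... | _ | yes refl =
      sees-two-misses-one⇒adjacent hvn
        ((r≢p ∷ ≢-sym i≢j ∷ j≢q ∷ []) ∷ (p≢i ∷ p≢q ∷ []) ∷ (i≢q ∷ []) ∷ [] ∷ []) Bw Ba Bx Bb v≁a v~x v~b
    ... | no r≢i | no r≢j =
      sees-two-misses-one⇒adjacent hvn
        ((r≢p ∷ r≢i ∷ r≢j ∷ []) ∷ (p≢i ∷ p≢j ∷ []) ∷ (i≢j ∷ []) ∷ [] ∷ []) Bw Ba Bx By v≁a v~x v~y

  addToPart-completeMultipartite : ∀ {v p} → B v ≡ nothing → v ∈ U → ¬ SeesPart v p →
    (∀ {w r} → B w ≡ just r → r ≢ p → Adj G v w) → CompleteMultipartiteIn G U k (addToPart B v p)
  addToPart-completeMultipartite {v} {p} v∉B v∈U unseen sees-rest = record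
    { inU      = inU′
    ; nonempty = λ r → let w , Bw = nonempty r in w , addToPart-extends {lab = B} {p = p} v∉B Bw
    ; stable   = stable′
    ; complete = complete′
    }
    where
    B′ = addToPart B v p

    view : ∀ {u r} → B′ u ≡ just r → (u ≡ v × r ≡ p) ⊎ B u ≡ just r
    view = addToPart-view {lab = B} v∉B

    inU′ : ∀ u r → B′ u ≡ just r → u ∈ U
    inU′ u r B′u with view B′u
    ... | inj₁ (refl , _) = v∈U
    ... | inj₂ Bu         = inU u r Bu

    stable′ : ∀ u w r → B′ u ≡ just r → B′ w ≡ just r → ¬ Adj G u w
    stable′ u w r B′u B′w with view B′u | view B′w
    ... | inj₁ (refl , _)    | inj₁ (refl , _)    = λ v~v → Adj⇒≢ G v~v refl
    ... | inj₁ (refl , refl) | inj₂ Bw            = λ v~w → unseen (w , Bw , v~w)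
    ... | inj₂ Bu            | inj₁ (refl , refl) = λ u~v → unseen (u , Bu , Adj-sym G u~v)
    ... | inj₂ Bu            | inj₂ Bw            = stable u w r Bu Bw

    complete′ : ∀ u w r s → B′ u ≡ just r → B′ w ≡ just s → r ≢ s → Adj G u w
    complete′ u w r s B′u B′w r≢s with view B′u | view B′w
    ... | inj₁ (_ , refl)    | inj₁ (_ , refl)    = contradiction refl r≢s
    ... | inj₁ (refl , refl) | inj₂ Bw            = sees-rest Bw (≢-sym r≢s)
    ... | inj₂ Bu            | inj₁ (refl , refl) = Adj-sym G (sees-rest Bu r≢s)
    ... | inj₂ Bu            | inj₂ Bw            = complete u w r s Bu Bw r≢s

  neighbours-in-one-part : Free G HVN → 4 ≤ k → (∀ S → IsCliqueIn G U S → ∣ S ∣ ≤ k) →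
    (∀ lab → CompleteMultipartiteIn G U k lab → order lab ≤ order B) →
    ∀ {v x y i j} → v ∈ U → B v ≡ nothing → B x ≡ just i → B y ≡ just j →
    Adj G v x → Adj G v y → i ≡ j
  neighbours-in-one-part hvn k≥4 bound maximal {v} {i = i} {j} v∈U v∉B Bx By v~x v~y =
    decidable-stable (i ≟ j) λ i≢j →
      let p , unseen = ¬∀⟶∃¬ k _ (sees? v) (¬sees-every-part bound v∈U)
          sees-rest  = adjacent-outside-unseen-part hvn k≥4 i≢j Bx By v~x v~y unseen
      in <⇒≱ (addToPart-order {lab = B} {p = p} v∉B)
             (maximal _ (addToPart-completeMultipartite v∉B v∈U unseen sees-rest))

lemma3p4 : ∀ {n} (G : Graph n) → Free G P2∪P4 → Free G HVN
    → (ω : ℕ) → CliqueNumberIn G ⊤ ω → 4 ≤ ω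
    → (A : Fin n → Maybe (Fin ω)) → MaxCompleteMultipartiteIn G ⊤ ω A
    → (k : ℕ) → CliqueNumberIn G (∁ (vertexSet A)) k → 4 ≤ k
    → (B : Fin n → Maybe (Fin k)) → MaxCompleteMultipartiteIn G (∁ (vertexSet A)) k B
    → ∀ v → v ∈ ∁ (vertexSet A) → B v ≡ nothing
    → ∀ x y i j → B x ≡ just i → B y ≡ just j → Adj G v x → Adj G v y → i ≡ j
lemma3p4 G _ hvn _ _ _ A _ k (_ , bound) k≥4 B (B-cmp , maximal) v v∈H v∉B x y i j =
  neighbours-in-one-part B-cmp hvn k≥4 bound maximal v∈H v∉B
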